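{- For the ruleset top entails, with $\boldsymbol{n}$ the heap of size $n$, $S_{\boldsymbol n}$ its set of immediate nimbers, $P_{\boldsymbol n}$ its set of protected nimbers and $\mathcal{N}$ the set of all nimbers: $P_{\boldsymbol 0}=S_{\boldsymbol 0}=\varnothing$, and for all $n>0$, $P_{\boldsymbol{n}}=\mathcal{N}\setminus(S_{\boldsymbol{n-1}}\cup P_{\boldsymbol{n-1}})$ and $S_{\boldsymbol n}=\{\mathcal G(\boldsymbol{\ell}+\boldsymbol m): \ell+m=n,\ \ell,m>0,\ \boldsymbol{\ell},\boldsymbol m\ne\{\infty\,|\,\overline{\infty}\}\}$.
   Context: Top entails is played on heaps of tokens: a player either removes the top token from one heap, or splits a heap into two nonempty heaps; after a top-token removal, the next move must be played on the same heap. In affine normal play (terminating games $\infty$ for Left win and $\overline{\infty}$ for Right win, absorbing under sum), the heap $\boldsymbol n$ has as Left options the splits $\boldsymbol\ell+\boldsymbol m$ ($\ell+m=n$, $\ell,m>0$) and the entailing option $\{\infty\,|\,(\boldsymbol{n-1})^{\mathcal R}\}$, symmetrically for Right. For an affine impartial game $G$, $S_G$ is the set of its Left options equal to nimbers, and $P_G$ (protected nimbers) is all nimbers if $\infty$ is a Left option, otherwise the set of $*n$ for which some Left-check option $G^{L}$ (one having $\infty$ as a Left option) satisfies $G^{L}+*n\in\mathscr{L}$. $\mathcal G$ is the Sprague–Grundy value; the moon $\{\infty\,|\,\overline{\infty}\}$ (value $\infty$) is the only non-nimber value modulo affine impartial equality, and $\boldsymbol n$ has value $\mathrm{mex}(\mathcal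 G(S_{\boldsymbol n}\cup P_{\boldsymbol n}))$, being the moon when $S_{\boldsymbol n}\cup P_{\boldsymbol n}$ is all nimbers. -}

module Defs where

open import Data.Nat using (ℕ; zero; suc; _∸_)
open import Data.List using (List; []; _∷_; _++_; map; upTo)
open import Data.List.Membership.Propositional using (_∈_)
open import Data.Product using (Σ; _×_)
open import Data.Sum using (_⊎_)
open import Data.Unit using (⊤)
open import Data.Empty using (⊥)
open import Function.Bundles using (_⇔_)

-- Affine (absorbing) game forms: the terminating games ∞ (Left wins),
-- -∞ (Right wins), and forms ⟨ Left options ∣ Right options ⟩.

data Game : Set where
  ∞   : Game
  -∞  : Game
  ⟨_∣_⟩ : List Game → List Game → Game

leftOpts : Game → List Game
leftOpts ⟨ L ∣ R ⟩ = L
leftOpts ∞ = []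
leftOpts -∞ = []

rightOpts : Game → List Game
rightOpts ⟨ L ∣ R ⟩ = R
rightOpts ∞ = []
rightOpts -∞ = []

-- Disjunctive sum; ∞ and -∞ are absorbing (a move to ∞ in a component
-- ends the whole game).
mutual
  infixl 6 _⊕_
  _⊕_ : Game → Game → Game
  ∞ ⊕ H = ∞
  -∞ ⊕ H = -∞
  ⟨ L ∣ R ⟩ ⊕ ∞ = ∞
  ⟨ L ∣ R ⟩ ⊕ -∞ = -∞
  g@(⟨ L ∣ R ⟩) ⊕ h@(⟨ L' ∣ R' ⟩) =
    ⟨ addˡ L h ++ addʳ g L' ∣ addˡ R h ++ addʳ g R' ⟩

  addˡ : List Game → Game → List Game
  addˡ [] h = []
  addˡ (x ∷ xs) h = (x ⊕ h) ∷ addˡ xs h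

  addʳ : Game → List Game → List Game
  addʳ g [] = []
  addʳ g (y ∷ ys) = (g ⊕ y) ∷ addʳ g ys

mutual
  neg : Game → Game
  neg ∞ = -∞
  neg -∞ = ∞
  neg ⟨ L ∣ R ⟩ = ⟨ negs R ∣ negs L ⟩

  negs : List Game → List Game
  negs [] = []
  negs (x ∷ xs) = neg x ∷ negs xs

-- Identity of game forms (option SETS identical, recursively).
mutual
  _≅_ : Game → Game → Set
  ∞ ≅ ∞ = ⊤
  -∞ ≅ -∞ = ⊤
  ⟨ L ∣ R ⟩ ≅ ⟨ L' ∣ R' ⟩ =
    (L ⊆≅ L') × (L ⊇≅ L') × (R ⊆≅ R') × (R ⊇≅ R')
  _ ≅ _ = ⊥

  _⊆≅_ : List Game → List Game → Set
  [] ⊆≅ ys = ⊤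
  (x ∷ xs) ⊆≅ ys = (x ∈≅ ys) × (xs ⊆≅ ys)

  _∈≅_ : Game → List Game → Set
  x ∈≅ [] = ⊥
  x ∈≅ (y ∷ ys) = (x ≅ y) ⊎ (x ∈≅ ys)

  _⊇≅_ : List Game → List Game → Set
  xs ⊇≅ [] = ⊤
  xs ⊇≅ (y ∷ ys) = (xs ∋≅ y) × (xs ⊇≅ ys)

  _∋≅_ : List Game → Game → Set
  [] ∋≅ y = ⊥
  (x ∷ xs) ∋≅ y = (x ≅ y) ⊎ (xs ∋≅ y)

Impartial : Game → Set
Impartial G = G ≅ neg G

mutual
  LWF : Game → Set
  LWF ∞ = ⊤
  LWF -∞ = ⊥
  LWF ⟨ L ∣ R ⟩ = anyLWS L

  LWS : Game → Set
  LWS ∞ = ⊤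
  LWS -∞ = ⊥
  LWS ⟨ L ∣ R ⟩ = allLWF R

  anyLWS : List Game → Set
  anyLWS [] = ⊥
  anyLWS (x ∷ xs) = LWS x ⊎ anyLWS xs

  allLWF : List Game → Set
  allLWF [] = ⊤
  allLWF (x ∷ xs) = LWF x × allLWF xs

mutual
  RWF : Game → Set
  RWF ∞ = ⊥
  RWF -∞ = ⊤
  RWF ⟨ L ∣ R ⟩ = anyRWS R

  RWS : Game → Set
  RWS ∞ = ⊥
  RWS -∞ = ⊤
  RWS ⟨ L ∣ R ⟩ = allRWF L

  anyRWS : List Game → Set
  anyRWS [] = ⊥
  anyRWS (x ∷ xs) = RWS x ⊎ anyRWS xs

  allRWF : List Game → Set
  allRWF [] = ⊤
  allRWF (x ∷ xs) = RWF x × allRWF xs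

In𝓛 : Game → Set
In𝓛 G = LWF G × LWS G

-- Equality of outcomes (outcome determined by the winner with Left
-- starting and the winner with Right starting).
SameOutcome : Game → Game → Set
SameOutcome G H = (LWF G ⇔ LWF H) × (RWF G ⇔ RWF H)

infix 4 _≈_
_≈_ : Game → Game → Set
G ≈ H = (X : Game) → Impartial X → SameOutcome (G ⊕ X) (H ⊕ X)

mutual
  nim : ℕ → Game
  nim k = ⟨ nimsBelow k ∣ nimsBelow k ⟩

  nimsBelow : ℕ → List Game
  nimsBelow zero = []
  nimsBelow (suc k) = nim k ∷ nimsBelow k

moon : Game
moon = ⟨ ∞ ∷ [] ∣ -∞ ∷ [] ⟩

-- Immediate nimbers S_G and protected nimbers P_G (as sets of k, for *k).

InS : Game → ℕ → Set
InS G k = Σ Game λ GL → (GL ∈ leftOpts G) × (GL ≈ nim k)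

InP : Game → ℕ → Set
InP G k =
  (∞ ∈ leftOpts G) ⊎
  Σ Game (λ GL → (GL ∈ leftOpts G) × (∞ ∈ leftOpts GL) × In𝓛 (GL ⊕ nim k))

-- Top entails heaps.  heapF f n is the heap of size n provided the
-- fuel f exceeds n (all recursive calls are on strictly smaller heaps).

heapF : ℕ → ℕ → Game
heapF zero n = ⟨ [] ∣ [] ⟩
heapF (suc f) zero = ⟨ [] ∣ [] ⟩
heapF (suc f) (suc m) =
  ⟨ splits ++ (⟨ ∞ ∷ [] ∣ rightOpts (heapF f m) ⟩ ∷ [])
  ∣ splits ++ (⟨ leftOpts (heapF f m) ∣ -∞ ∷ [] ⟩ ∷ []) ⟩
  where
  -- ℓ ranges over 1 .. m, the other part is (m+1) - ℓ
  splits : List Game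
  splits = map (λ ℓ → heapF f ℓ ⊕ heapF f (suc m ∸ ℓ)) (map suc (upTo m))

heap : ℕ → Game
heap n = heapF (suc n) n

{-# OPTIONS --safe #-}
-- The only Left-check option of the heap n is the entailing option E = {∞ | (n-1)^R},
-- so *k is protected in n exactly when Left wins E + *k moving second, i.e. when Left
-- wins r + *k moving first for every Right option r of n-1. For a split r this fails
-- exactly when r = *k, because an impartial game whose sum with *k is a second-player
-- win equals *k; for the entailing Right option {(n-2)^L | -∞} of n-1 it fails, by
-- conjugation, exactly when *k is protected in n-1. The immediate nimbers of n are the
-- values of its splits (E is never a nimber, as Left wins E + *k moving first), and a
-- summand equal to the moon would let Left win the sum plus *k, so no split with a
-- nimber value has one.
module Submission where

open import Defs
open import Data.Nat using (ℕ; zero; suc; _+_; _∸_; _<_; _≤_; z≤n; s≤s)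
open import Data.Nat.Properties
  using (≤-refl; ≤-pred; ≤-<-trans; m≤n⇒m≤1+n; m≤n⇒m<n∨m≡n; m∸n≤m;
         m+[n∸m]≡n; m+n∸m≡n; m<n⇒0<n∸m; m<m+n; m≤n+m; <⇒≤; suc-injective)
open import Data.List using (List; []; _∷_; _++_; map; upTo)
open import Data.List.Properties using (map-id; map-++; map-∘; map-cong-local; ++-assoc)
open import Data.List.Relation.Unary.All using (tabulate)
open import Data.List.Membership.Propositional using (_∈_)
open import Data.List.Membership.Propositional.Properties
  using (∈-++⁺ˡ; ∈-++⁺ʳ; ∈-++⁻; ∈-map⁺; ∈-map⁻; ∈-upTo⁺; ∈-upTo⁻)
open import Data.List.Relation.Unary.Any using (here; there)
open import Data.Product using (Σ; ∃-syntax; _×_; _,_; proj₁; proj₂)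
open import Data.Sum using (_⊎_; inj₁; inj₂)
open import Data.Unit using (tt)
open import Data.Empty using (⊥-elim)
open import Function using (_∘_; flip; id)
open import Function.Bundles using (_⇔_; mk⇔; Equivalence)
import Function.Properties.Equivalence as ⇔
open import Induction.WellFounded using (Acc; acc; WellFounded)
open import Relation.Nullary using (¬_)
open import Relation.Binary.Bundles using (Setoid)
import Relation.Binary.Reasoning.Setoid as SetoidReasoning
open import Level using (0ℓ)
open import Relation.Binary.PropositionalEquality
  using (_≡_; refl; sym; trans; cong; cong₂; subst; module ≡-Reasoning)

-- Options, and identity of forms

data _◃_ : Game → Game → Set where
  ◃ˡ : ∀ {x L R} → x ∈ L → x ◃ ⟨ L ∣ R ⟩
  ◃ʳ : ∀ {x L R} → x ∈ R → x ◃ ⟨ L ∣ R ⟩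

mutual
  ◃-wellFounded : WellFounded _◃_
  ◃-wellFounded ∞ = acc λ ()
  ◃-wellFounded -∞ = acc λ ()
  ◃-wellFounded ⟨ L ∣ R ⟩ = acc λ { (◃ˡ p) → ∈-acc L p ; (◃ʳ p) → ∈-acc R p }

  ∈-acc : ∀ {x} xs → x ∈ xs → Acc _◃_ x
  ∈-acc (y ∷ ys) (here refl) = ◃-wellFounded y
  ∈-acc (y ∷ ys) (there p) = ∈-acc ys p

data Side : Set where
  left right : Side

opts : Side → Game → List Game
opts left = leftOpts
opts right = rightOpts

opposite : Side → Side
opposite left = right
opposite right = left

data Form : Game → Set where
  ⟨⟩ : ∀ {L R} → Form ⟨ L ∣ R ⟩

◃-opts : ∀ {G x} → Form G → ∀ s → x ∈ opts s G → x ◃ G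
◃-opts ⟨⟩ left = ◃ˡ
◃-opts ⟨⟩ right = ◃ʳ

Match : {A : Set} → (A → A → Set) → List A → List A → Set
Match _∼_ xs ys = ∀ {x} → x ∈ xs → ∃[ y ] y ∈ ys × x ∼ y

infix 4 _≋_
_≋_ : List Game → List Game → Set
xs ≋ ys = Match _≅_ xs ys × Match (flip _≅_) ys xs

∈≅⇔Match : ∀ {x} ys → x ∈≅ ys ⇔ (∃[ y ] y ∈ ys × x ≅ y)
∈≅⇔Match {x} ys = mk⇔ (to ys) from
  where
  to : ∀ ys → x ∈≅ ys → ∃[ y ] y ∈ ys × x ≅ y
  to (y ∷ ys) (inj₁ e) = y , here refl , e
  to (y ∷ ys) (inj₂ p) with z , z∈ , e ← to ys p = z , there z∈ , e
  from : ∀ {ys} → (∃[ y ] y ∈ ys × x ≅ y) → x ∈≅ ys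
  from (y , here refl , e) = inj₁ e
  from (y , there y∈ , e) = inj₂ (from (y , y∈ , e))

∋≅⇔Match : ∀ {y} xs → xs ∋≅ y ⇔ (∃[ x ] x ∈ xs × x ≅ y)
∋≅⇔Match {y} xs = mk⇔ (to xs) from
  where
  to : ∀ xs → xs ∋≅ y → ∃[ x ] x ∈ xs × x ≅ y
  to (x ∷ xs) (inj₁ e) = x , here refl , e
  to (x ∷ xs) (inj₂ p) with z , z∈ , e ← to xs p = z , there z∈ , e
  from : ∀ {xs} → (∃[ x ] x ∈ xs × x ≅ y) → xs ∋≅ y
  from (x , here refl , e) = inj₁ e
  from (x , there x∈ , e) = inj₂ (from (x , x∈ , e))

⊆≅⇔Match : ∀ xs {ys} → xs ⊆≅ ys ⇔ Match _≅_ xs ys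
⊆≅⇔Match xs {ys} = mk⇔ (to xs) (from xs)
  where
  to : ∀ xs → xs ⊆≅ ys → Match _≅_ xs ys
  to (x ∷ xs) (p , _) (here refl) = Equivalence.to (∈≅⇔Match ys) p
  to (x ∷ xs) (_ , ps) (there x∈) = to xs ps x∈
  from : ∀ xs → Match _≅_ xs ys → xs ⊆≅ ys
  from [] m = tt
  from (x ∷ xs) m = Equivalence.from (∈≅⇔Match ys) (m (here refl)) , from xs (m ∘ there)

⊇≅⇔Match : ∀ {xs} ys → xs ⊇≅ ys ⇔ Match (flip _≅_) ys xs
⊇≅⇔Match {xs} ys = mk⇔ (to ys) (from ys)
  where
  to : ∀ ys → xs ⊇≅ ys → Match (flip _≅_) ys xs
  to (y ∷ ys) (p , _) (here refl) = Equivalence.to (∋≅⇔Match xs) p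
  to (y ∷ ys) (_ , ps) (there y∈) = to ys ps y∈
  from : ∀ ys → Match (flip _≅_) ys xs → xs ⊇≅ ys
  from [] m = tt
  from (y ∷ ys) m = Equivalence.from (∋≅⇔Match xs) (m (here refl)) , from ys (m ∘ there)

≅⇔≋ : ∀ {G H} → Form G → Form H → G ≅ H ⇔ (∀ s → opts s G ≋ opts s H)
≅⇔≋ {⟨ L ∣ R ⟩} {⟨ L' ∣ R' ⟩} ⟨⟩ ⟨⟩ = mk⇔ to from
  where
  to : ⟨ L ∣ R ⟩ ≅ ⟨ L' ∣ R' ⟩ → ∀ s → opts s ⟨ L ∣ R ⟩ ≋ opts s ⟨ L' ∣ R' ⟩
  to (a , b , c , d) left = Equivalence.to (⊆≅⇔Match L) a , Equivalence.to (⊇≅⇔Match L') b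
  to (a , b , c , d) right = Equivalence.to (⊆≅⇔Match R) c , Equivalence.to (⊇≅⇔Match R') d
  from : (∀ s → opts s ⟨ L ∣ R ⟩ ≋ opts s ⟨ L' ∣ R' ⟩) → ⟨ L ∣ R ⟩ ≅ ⟨ L' ∣ R' ⟩
  from e with (a , b) ← e left | (c , d) ← e right =
    Equivalence.from (⊆≅⇔Match L) a , Equivalence.from (⊇≅⇔Match L') b ,
    Equivalence.from (⊆≅⇔Match R) c , Equivalence.from (⊇≅⇔Match R') d

≅⇒≋ : ∀ {G H} → Form G → Form H → G ≅ H → ∀ s → opts s G ≋ opts s H
≅⇒≋ g h = Equivalence.to (≅⇔≋ g h)

≋⇒≅ : ∀ {G H} → Form G → Form H → (∀ s → opts s G ≋ opts s H) → G ≅ H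
≋⇒≅ g h = Equivalence.from (≅⇔≋ g h)

-- The primed versions assume their property only for elements of xs, which lets
-- them be used under well-founded recursion on options.
≋-refl′ : ∀ {xs} → (∀ {x} → x ∈ xs → x ≅ x) → xs ≋ xs
≋-refl′ r = (λ p → _ , p , r p) , (λ p → _ , p , r p)

≋-sym′ : ∀ {xs ys} → (∀ {x y} → x ∈ xs → x ≅ y → y ≅ x) → xs ≋ ys → ys ≋ xs
≋-sym′ s (a , b) =
  (λ q → let x , p , e = b q in x , p , s p e) ,
  (λ p → let y , q , e = a p in y , q , s p e)

≋-trans′ : ∀ {xs ys zs} → (∀ {x y z} → x ∈ xs → x ≅ y → y ≅ z → x ≅ z) →
           xs ≋ ys → ys ≋ zs → xs ≋ zs
≋-trans′ t (a , b) (a' , b') =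
  (λ p → let y , q , e = a p ; z , r , e' = a' q in z , r , t p e e') ,
  (λ r → let y , q , e' = b' r ; x , p , e = b q in x , p , t p e e')

≅-refl : ∀ G → G ≅ G
≅-refl G = go (◃-wellFounded G)
  where
  go : ∀ {G} → Acc _◃_ G → G ≅ G
  go {∞} _ = tt
  go { -∞} _ = tt
  go {⟨ L ∣ R ⟩} (acc rs) = ≋⇒≅ ⟨⟩ ⟨⟩ λ s → ≋-refl′ (λ p → go (rs (◃-opts ⟨⟩ s p)))

≅-sym : ∀ {G H} → G ≅ H → H ≅ G
≅-sym {G} = go (◃-wellFounded G)
  where
  go : ∀ {G H} → Acc _◃_ G → G ≅ H → H ≅ G
  go {∞} {∞} _ _ = tt
  go { -∞} { -∞} _ _ = tt
  go {⟨ L ∣ R ⟩} {⟨ L' ∣ R' ⟩} (acc rs) e = ≋⇒≅ ⟨⟩ ⟨⟩ λ s →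
    ≋-sym′ (λ p → go (rs (◃-opts ⟨⟩ s p))) (≅⇒≋ ⟨⟩ ⟨⟩ e s)

≅-trans : ∀ {G H K} → G ≅ H → H ≅ K → G ≅ K
≅-trans {G} = go (◃-wellFounded G)
  where
  go : ∀ {G H K} → Acc _◃_ G → G ≅ H → H ≅ K → G ≅ K
  go {∞} {∞} {∞} _ _ _ = tt
  go { -∞} { -∞} { -∞} _ _ _ = tt
  go {⟨ _ ∣ _ ⟩} {⟨ _ ∣ _ ⟩} {⟨ _ ∣ _ ⟩} (acc rs) e e' = ≋⇒≅ ⟨⟩ ⟨⟩ λ s →
    ≋-trans′ (λ p → go (rs (◃-opts ⟨⟩ s p)))
      (≅⇒≋ ⟨⟩ ⟨⟩ e s) (≅⇒≋ ⟨⟩ ⟨⟩ e' s)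

≋-refl : ∀ {xs} → xs ≋ xs
≋-refl = ≋-refl′ λ {x} _ → ≅-refl x

≋-sym : ∀ {xs ys} → xs ≋ ys → ys ≋ xs
≋-sym = ≋-sym′ λ _ → ≅-sym

≋-trans : ∀ {xs ys zs} → xs ≋ ys → ys ≋ zs → xs ≋ zs
≋-trans = ≋-trans′ λ _ → ≅-trans

≅-setoid : Setoid 0ℓ 0ℓ
≅-setoid = record
  { Carrier = Game ; _≈_ = _≅_
  ; isEquivalence = record { refl = λ {G} → ≅-refl G ; sym = ≅-sym ; trans = ≅-trans } }

≋-setoid : Setoid 0ℓ 0ℓ
≋-setoid = record
  { Carrier = List Game ; _≈_ = _≋_
  ; isEquivalence = record { refl = ≋-refl ; sym = ≋-sym ; trans = ≋-trans } }

module ≅-Reasoning = SetoidReasoning ≅-setoid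
module ≋-Reasoning = SetoidReasoning ≋-setoid

Match-refl : ∀ {A} {xs : List A} → Match _≡_ xs xs
Match-refl p = _ , p , refl

Match-++ : ∀ {A} {_∼_ : A → A → Set} {xs ys zs ws} →
           Match _∼_ xs zs → Match _∼_ ys ws → Match _∼_ (xs ++ ys) (zs ++ ws)
Match-++ {xs = xs} {zs = zs} m n p with ∈-++⁻ xs p
... | inj₁ q = let z , r , e = m q in z , ∈-++⁺ˡ r , e
... | inj₂ q = let w , r , e = n q in w , ∈-++⁺ʳ zs r , e

Match-++-swap : ∀ {A} {_∼_ : A → A → Set} {xs ys zs ws} →
                Match _∼_ xs ws → Match _∼_ ys zs → Match _∼_ (xs ++ ys) (zs ++ ws)
Match-++-swap {xs = xs} {zs = zs} m n p with ∈-++⁻ xs p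
... | inj₁ q = let w , r , e = m q in w , ∈-++⁺ʳ zs r , e
... | inj₂ q = let z , r , e = n q in z , ∈-++⁺ˡ r , e

Match-map : ∀ {A} {_∼_ _≈′_ : A → A → Set} {f g : A → A} {xs ys} →
            (∀ {x y} → x ∈ xs → y ∈ ys → x ∼ y → f x ≈′ g y) →
            Match _∼_ xs ys → Match _≈′_ (map f xs) (map g ys)
Match-map {f = f} {g} h m p with x , x∈ , refl ← ∈-map⁻ f p =
  let y , y∈ , e = m x∈ in g y , ∈-map⁺ g y∈ , h x∈ y∈ e

++⁺-≋ : ∀ {xs xs' ys ys'} → xs ≋ xs' → ys ≋ ys' → xs ++ ys ≋ xs' ++ ys'
++⁺-≋ (a , b) (c , d) = Match-++ a c , Match-++ b d

++-comm-≋ : ∀ xs ys → xs ++ ys ≋ ys ++ xs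
++-comm-≋ xs ys =
  Match-++-swap {xs = xs} {ys} (proj₁ ≋-refl) (proj₁ ≋-refl) ,
  Match-++-swap {xs = ys} {xs} (proj₂ ≋-refl) (proj₂ ≋-refl)

map⁺-≋ : ∀ {f g xs ys} → (∀ {x y} → x ∈ xs → x ≅ y → f x ≅ g y) → xs ≋ ys → map f xs ≋ map g ys
map⁺-≋ h (a , b) = Match-map (λ x∈ _ → h x∈) a , Match-map (λ _ x∈ → h x∈) b

map-pointwise-≋ : ∀ {f g xs} → (∀ {x} → x ∈ xs → f x ≅ g x) → map f xs ≋ map g xs
map-pointwise-≋ {f} {g} {xs} h =
  Match-map {_∼_ = _≡_} {_≅_} {f} {g} {xs} (λ { x∈ _ refl → h x∈ }) Match-refl ,
  Match-map {_∼_ = _≡_} {flip _≅_} {g} {f} {xs} (λ { x∈ _ refl → h x∈ }) Match-refl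

-- Sums

addˡ≡map : ∀ xs h → addˡ xs h ≡ map (_⊕ h) xs
addˡ≡map [] h = refl
addˡ≡map (x ∷ xs) h = cong (x ⊕ h ∷_) (addˡ≡map xs h)

addʳ≡map : ∀ g ys → addʳ g ys ≡ map (g ⊕_) ys
addʳ≡map g [] = refl
addʳ≡map g (y ∷ ys) = cong (g ⊕ y ∷_) (addʳ≡map g ys)

Form-⊕ : ∀ {A B} → Form A → Form B → Form (A ⊕ B)
Form-⊕ ⟨⟩ ⟨⟩ = ⟨⟩

⊕-opts : ∀ {A B} → Form A → Form B → ∀ s →
         opts s (A ⊕ B) ≡ map (_⊕ B) (opts s A) ++ map (A ⊕_) (opts s B)
⊕-opts {⟨ LA ∣ RA ⟩} {⟨ LB ∣ RB ⟩} ⟨⟩ ⟨⟩ left = cong₂ _++_ (addˡ≡map LA _) (addʳ≡map _ LB)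
⊕-opts {⟨ LA ∣ RA ⟩} {⟨ LB ∣ RB ⟩} ⟨⟩ ⟨⟩ right = cong₂ _++_ (addˡ≡map RA _) (addʳ≡map _ RB)

∈-⊕ˡ : ∀ {A B x} → Form A → Form B → ∀ s → x ∈ opts s A → x ⊕ B ∈ opts s (A ⊕ B)
∈-⊕ˡ {B = B} a b s p = subst (_ ∈_) (sym (⊕-opts a b s)) (∈-++⁺ˡ (∈-map⁺ (_⊕ B) p))

∈-⊕ʳ : ∀ {A B y} → Form A → Form B → ∀ s → y ∈ opts s B → A ⊕ y ∈ opts s (A ⊕ B)
∈-⊕ʳ {A} a b s p = subst (_ ∈_) (sym (⊕-opts a b s)) (∈-++⁺ʳ _ (∈-map⁺ (A ⊕_) p))

∈-⊕⁻ : ∀ {A B z} → Form A → Form B → ∀ s → z ∈ opts s (A ⊕ B) →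
       (∃[ x ] x ∈ opts s A × z ≡ x ⊕ B) ⊎ (∃[ y ] y ∈ opts s B × z ≡ A ⊕ y)
∈-⊕⁻ {A} {B} a b s p with ∈-++⁻ (map (_⊕ B) (opts s A)) (subst (_ ∈_) (⊕-opts a b s) p)
... | inj₁ q = inj₁ (∈-map⁻ (_⊕ B) q)
... | inj₂ q = inj₂ (∈-map⁻ (A ⊕_) q)

⊕-cong : ∀ {A A' B B'} → A ≅ A' → B ≅ B' → (A ⊕ B) ≅ (A' ⊕ B')
⊕-cong {A} {B = B} = go (◃-wellFounded A) (◃-wellFounded B)
  where
  go : ∀ {A A' B B'} → Acc _◃_ A → Acc _◃_ B → A ≅ A' → B ≅ B' → (A ⊕ B) ≅ (A' ⊕ B')
  go {∞} {∞} _ _ _ _ = tt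
  go { -∞} { -∞} _ _ _ _ = tt
  go {⟨ _ ∣ _ ⟩} {⟨ _ ∣ _ ⟩} {∞} {∞} _ _ _ _ = tt
  go {⟨ _ ∣ _ ⟩} {⟨ _ ∣ _ ⟩} { -∞} { -∞} _ _ _ _ = tt
  go {A@(⟨ _ ∣ _ ⟩)} {A'@(⟨ _ ∣ _ ⟩)} {B@(⟨ _ ∣ _ ⟩)} {B'@(⟨ _ ∣ _ ⟩)} (acc ra) (acc rb) e f =
    ≋⇒≅ ⟨⟩ ⟨⟩ λ s → begin
      opts s (A ⊕ B)                                     ≡⟨ ⊕-opts ⟨⟩ ⟨⟩ s ⟩
      map (_⊕ B) (opts s A) ++ map (A ⊕_) (opts s B)     ≈⟨ ++⁺-≋
        (map⁺-≋ (λ p e′ → go (ra (◃-opts ⟨⟩ s p)) (acc rb) e′ f) (≅⇒≋ ⟨⟩ ⟨⟩ e s))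
        (map⁺-≋ (λ p f′ → go (acc ra) (rb (◃-opts ⟨⟩ s p)) e f′) (≅⇒≋ ⟨⟩ ⟨⟩ f s)) ⟩
      map (_⊕ B') (opts s A') ++ map (A' ⊕_) (opts s B') ≡⟨ ⊕-opts ⟨⟩ ⟨⟩ s ⟨
      opts s (A' ⊕ B')                                   ∎
    where open ≋-Reasoning

⊕-comm : ∀ A {B} → Form B → (A ⊕ B) ≅ (B ⊕ A)
⊕-comm A {B} = go (◃-wellFounded A) (◃-wellFounded B)
  where
  go : ∀ {A B} → Acc _◃_ A → Acc _◃_ B → Form B → (A ⊕ B) ≅ (B ⊕ A)
  go {∞} _ _ ⟨⟩ = tt
  go { -∞} _ _ ⟨⟩ = tt
  go {A@(⟨ _ ∣ _ ⟩)} {B} (acc ra) (acc rb) ⟨⟩ = ≋⇒≅ ⟨⟩ ⟨⟩ λ s → begin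
    opts s (A ⊕ B)                                  ≡⟨ ⊕-opts ⟨⟩ ⟨⟩ s ⟩
    map (_⊕ B) (opts s A) ++ map (A ⊕_) (opts s B)  ≈⟨ ++⁺-≋
      (map-pointwise-≋ λ p → go (ra (◃-opts ⟨⟩ s p)) (acc rb) ⟨⟩)
      (map-pointwise-≋ λ p → ≅-sym (go (rb (◃-opts ⟨⟩ s p)) (acc ra) ⟨⟩)) ⟩
    map (B ⊕_) (opts s A) ++ map (_⊕ A) (opts s B)  ≈⟨ ++-comm-≋ (map (B ⊕_) (opts s A)) _ ⟩
    map (_⊕ A) (opts s B) ++ map (B ⊕_) (opts s A)  ≡⟨ ⊕-opts ⟨⟩ ⟨⟩ s ⟨
    opts s (B ⊕ A)                                  ∎
    where open ≋-Reasoning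

⊕-opts-assocˡ : ∀ {A B C} → Form A → Form B → Form C → ∀ s →
  opts s ((A ⊕ B) ⊕ C) ≡
  map (λ x → (x ⊕ B) ⊕ C) (opts s A) ++ map (λ y → (A ⊕ y) ⊕ C) (opts s B) ++ map ((A ⊕ B) ⊕_) (opts s C)
⊕-opts-assocˡ {A} {B} {C} a b c s = begin
  opts s ((A ⊕ B) ⊕ C)
    ≡⟨ ⊕-opts (Form-⊕ a b) c s ⟩
  map (_⊕ C) (opts s (A ⊕ B)) ++ map ((A ⊕ B) ⊕_) (opts s C)
    ≡⟨ cong (λ xs → map (_⊕ C) xs ++ map ((A ⊕ B) ⊕_) (opts s C)) (⊕-opts a b s) ⟩
  map (_⊕ C) (map (_⊕ B) (opts s A) ++ map (A ⊕_) (opts s B)) ++ map ((A ⊕ B) ⊕_) (opts s C)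
    ≡⟨ cong (_++ map ((A ⊕ B) ⊕_) (opts s C)) (map-++ (_⊕ C) (map (_⊕ B) (opts s A)) _) ⟩
  (map (_⊕ C) (map (_⊕ B) (opts s A)) ++ map (_⊕ C) (map (A ⊕_) (opts s B))) ++ map ((A ⊕ B) ⊕_) (opts s C)
    ≡⟨ ++-assoc (map (_⊕ C) (map (_⊕ B) (opts s A))) _ _ ⟩
  map (_⊕ C) (map (_⊕ B) (opts s A)) ++ map (_⊕ C) (map (A ⊕_) (opts s B)) ++ map ((A ⊕ B) ⊕_) (opts s C)
    ≡⟨ cong₂ (λ xs ys → xs ++ ys ++ map ((A ⊕ B) ⊕_) (opts s C)) (map-∘ (opts s A)) (map-∘ (opts s B)) ⟨
  map (λ x → (x ⊕ B) ⊕ C) (opts s A) ++ map (λ y → (A ⊕ y) ⊕ C) (opts s B) ++ map ((A ⊕ B) ⊕_) (opts s C) ∎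
  where open ≡-Reasoning

⊕-opts-assocʳ : ∀ {A B C} → Form A → Form B → Form C → ∀ s →
  opts s (A ⊕ (B ⊕ C)) ≡
  map (_⊕ (B ⊕ C)) (opts s A) ++ map (λ y → A ⊕ (y ⊕ C)) (opts s B) ++ map (λ z → A ⊕ (B ⊕ z)) (opts s C)
⊕-opts-assocʳ {A} {B} {C} a b c s = begin
  opts s (A ⊕ (B ⊕ C))
    ≡⟨ ⊕-opts a (Form-⊕ b c) s ⟩
  map (_⊕ (B ⊕ C)) (opts s A) ++ map (A ⊕_) (opts s (B ⊕ C))
    ≡⟨ cong (λ xs → map (_⊕ (B ⊕ C)) (opts s A) ++ map (A ⊕_) xs) (⊕-opts b c s) ⟩
  map (_⊕ (B ⊕ C)) (opts s A) ++ map (A ⊕_) (map (_⊕ C) (opts s B) ++ map (B ⊕_) (opts s C))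
    ≡⟨ cong (map (_⊕ (B ⊕ C)) (opts s A) ++_) (map-++ (A ⊕_) (map (_⊕ C) (opts s B)) _) ⟩
  map (_⊕ (B ⊕ C)) (opts s A) ++ map (A ⊕_) (map (_⊕ C) (opts s B)) ++ map (A ⊕_) (map (B ⊕_) (opts s C))
    ≡⟨ cong₂ (λ ys zs → map (_⊕ (B ⊕ C)) (opts s A) ++ ys ++ zs) (map-∘ (opts s B)) (map-∘ (opts s C)) ⟨
  map (_⊕ (B ⊕ C)) (opts s A) ++ map (λ y → A ⊕ (y ⊕ C)) (opts s B) ++ map (λ z → A ⊕ (B ⊕ z)) (opts s C) ∎
  where open ≡-Reasoning

⊕-assoc : ∀ A B C → ((A ⊕ B) ⊕ C) ≅ (A ⊕ (B ⊕ C))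
⊕-assoc A B C = go (◃-wellFounded A) (◃-wellFounded B) (◃-wellFounded C)
  where
  go : ∀ {A B C} → Acc _◃_ A → Acc _◃_ B → Acc _◃_ C → ((A ⊕ B) ⊕ C) ≅ (A ⊕ (B ⊕ C))
  go {∞} _ _ _ = tt
  go { -∞} _ _ _ = tt
  go {⟨ _ ∣ _ ⟩} {∞} _ _ _ = tt
  go {⟨ _ ∣ _ ⟩} { -∞} _ _ _ = tt
  go {⟨ _ ∣ _ ⟩} {⟨ _ ∣ _ ⟩} {∞} _ _ _ = tt
  go {⟨ _ ∣ _ ⟩} {⟨ _ ∣ _ ⟩} { -∞} _ _ _ = tt
  go {A@(⟨ _ ∣ _ ⟩)} {B@(⟨ _ ∣ _ ⟩)} {C@(⟨ _ ∣ _ ⟩)} (acc ra) (acc rb) (acc rc) = ≋⇒≅ ⟨⟩ ⟨⟩ λ s → begin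
    opts s ((A ⊕ B) ⊕ C)
      ≡⟨ ⊕-opts-assocˡ ⟨⟩ ⟨⟩ ⟨⟩ s ⟩
    map (λ x → (x ⊕ B) ⊕ C) (opts s A) ++ map (λ y → (A ⊕ y) ⊕ C) (opts s B) ++ map ((A ⊕ B) ⊕_) (opts s C)
      ≈⟨ ++⁺-≋ (map-pointwise-≋ λ p → go (ra (◃-opts ⟨⟩ s p)) (acc rb) (acc rc))
        (++⁺-≋ (map-pointwise-≋ λ p → go (acc ra) (rb (◃-opts ⟨⟩ s p)) (acc rc))
               (map-pointwise-≋ λ p → go (acc ra) (acc rb) (rc (◃-opts ⟨⟩ s p)))) ⟩
    map (_⊕ (B ⊕ C)) (opts s A) ++ map (λ y → A ⊕ (y ⊕ C)) (opts s B) ++ map (λ z → A ⊕ (B ⊕ z)) (opts s C)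
      ≡⟨ ⊕-opts-assocʳ ⟨⟩ ⟨⟩ ⟨⟩ s ⟨
    opts s (A ⊕ (B ⊕ C)) ∎
    where open ≋-Reasoning

-- Conjugation

negs≡map : ∀ xs → negs xs ≡ map neg xs
negs≡map [] = refl
negs≡map (x ∷ xs) = cong (neg x ∷_) (negs≡map xs)

Form-neg : ∀ {G} → Form G → Form (neg G)
Form-neg ⟨⟩ = ⟨⟩

neg-opts : ∀ {G} → Form G → ∀ s → opts s (neg G) ≡ negs (opts (opposite s) G)
neg-opts ⟨⟩ left = refl
neg-opts ⟨⟩ right = refl

mutual
  neg-involutive : ∀ G → neg (neg G) ≡ G
  neg-involutive ∞ = refl
  neg-involutive -∞ = refl
  neg-involutive ⟨ L ∣ R ⟩ = cong₂ ⟨_∣_⟩ (negs-involutive L) (negs-involutive R)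

  negs-involutive : ∀ xs → negs (negs xs) ≡ xs
  negs-involutive [] = refl
  negs-involutive (x ∷ xs) = cong₂ _∷_ (neg-involutive x) (negs-involutive xs)

negs-++ : ∀ xs ys → negs (xs ++ ys) ≡ negs xs ++ negs ys
negs-++ [] ys = refl
negs-++ (x ∷ xs) ys = cong (neg x ∷_) (negs-++ xs ys)

mutual
  neg-distrib-⊕ : ∀ A B → neg (A ⊕ B) ≡ neg A ⊕ neg B
  neg-distrib-⊕ ∞ B = refl
  neg-distrib-⊕ -∞ B = refl
  neg-distrib-⊕ ⟨ L ∣ R ⟩ ∞ = refl
  neg-distrib-⊕ ⟨ L ∣ R ⟩ -∞ = refl
  neg-distrib-⊕ A@(⟨ L ∣ R ⟩) B@(⟨ L' ∣ R' ⟩) = cong₂ ⟨_∣_⟩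
    (trans (negs-++ (addˡ R B) (addʳ A R')) (cong₂ _++_ (negs-addˡ R B) (negs-addʳ A R')))
    (trans (negs-++ (addˡ L B) (addʳ A L')) (cong₂ _++_ (negs-addˡ L B) (negs-addʳ A L')))

  negs-addˡ : ∀ xs B → negs (addˡ xs B) ≡ addˡ (negs xs) (neg B)
  negs-addˡ [] B = refl
  negs-addˡ (x ∷ xs) B = cong₂ _∷_ (neg-distrib-⊕ x B) (negs-addˡ xs B)

  negs-addʳ : ∀ A ys → negs (addʳ A ys) ≡ addʳ (neg A) (negs ys)
  negs-addʳ A [] = refl
  negs-addʳ A (y ∷ ys) = cong₂ _∷_ (neg-distrib-⊕ A y) (negs-addʳ A ys)

neg-cong : ∀ {G H} → G ≅ H → neg G ≅ neg H
neg-cong {G} = go (◃-wellFounded G)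
  where
  go : ∀ {G H} → Acc _◃_ G → G ≅ H → neg G ≅ neg H
  go {∞} {∞} _ _ = tt
  go { -∞} { -∞} _ _ = tt
  go {G@(⟨ _ ∣ _ ⟩)} {H@(⟨ _ ∣ _ ⟩)} (acc r) e = ≋⇒≅ ⟨⟩ ⟨⟩ λ s → begin
    opts s (neg G)                   ≡⟨ trans (neg-opts ⟨⟩ s) (negs≡map _) ⟩
    map neg (opts (opposite s) G)    ≈⟨ map⁺-≋ (λ p → go (r (◃-opts ⟨⟩ (opposite s) p)))
                                                (≅⇒≋ ⟨⟩ ⟨⟩ e (opposite s)) ⟩
    map neg (opts (opposite s) H)    ≡⟨ trans (neg-opts ⟨⟩ s) (negs≡map _) ⟨
    opts s (neg H)                   ∎
    where open ≋-Reasoning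

mutual
  LWF-neg : ∀ G → LWF (neg G) ≡ RWF G
  LWF-neg ∞ = refl
  LWF-neg -∞ = refl
  LWF-neg ⟨ L ∣ R ⟩ = anyLWS-negs R

  LWS-neg : ∀ G → LWS (neg G) ≡ RWS G
  LWS-neg ∞ = refl
  LWS-neg -∞ = refl
  LWS-neg ⟨ L ∣ R ⟩ = allLWF-negs L

  anyLWS-negs : ∀ xs → anyLWS (negs xs) ≡ anyRWS xs
  anyLWS-negs [] = refl
  anyLWS-negs (x ∷ xs) = cong₂ _⊎_ (LWS-neg x) (anyLWS-negs xs)

  allLWF-negs : ∀ xs → allLWF (negs xs) ≡ allRWF xs
  allLWF-negs [] = refl
  allLWF-negs (x ∷ xs) = cong₂ _×_ (LWF-neg x) (allLWF-negs xs)

RWS-neg : ∀ G → RWS (neg G) ≡ LWS G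
RWS-neg G = trans (sym (LWS-neg (neg G))) (cong LWS (neg-involutive G))

-- Outcomes

anyLWS⁻ : ∀ {xs} → anyLWS xs → ∃[ x ] x ∈ xs × LWS x
anyLWS⁻ {x ∷ xs} (inj₁ w) = x , here refl , w
anyLWS⁻ {x ∷ xs} (inj₂ w) with y , y∈ , v ← anyLWS⁻ w = y , there y∈ , v

anyLWS⁺ : ∀ {x xs} → x ∈ xs → LWS x → anyLWS xs
anyLWS⁺ (here refl) w = inj₁ w
anyLWS⁺ (there x∈) w = inj₂ (anyLWS⁺ x∈ w)

allLWF⁻ : ∀ {x xs} → allLWF xs → x ∈ xs → LWF x
allLWF⁻ (w , _) (here refl) = w
allLWF⁻ (_ , ws) (there x∈) = allLWF⁻ ws x∈

allLWF⁺ : ∀ {xs} → (∀ {x} → x ∈ xs → LWF x) → allLWF xs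
allLWF⁺ {[]} h = tt
allLWF⁺ {x ∷ xs} h = h (here refl) , allLWF⁺ (h ∘ there)

mutual
  LWF⊎RWS : ∀ G → LWF G ⊎ RWS G
  LWF⊎RWS ∞ = inj₁ tt
  LWF⊎RWS -∞ = inj₂ tt
  LWF⊎RWS ⟨ L ∣ R ⟩ = anyLWS⊎allRWF L

  LWS⊎RWF : ∀ G → LWS G ⊎ RWF G
  LWS⊎RWF ∞ = inj₁ tt
  LWS⊎RWF -∞ = inj₂ tt
  LWS⊎RWF ⟨ L ∣ R ⟩ = allLWF⊎anyRWS R

  anyLWS⊎allRWF : ∀ xs → anyLWS xs ⊎ allRWF xs
  anyLWS⊎allRWF [] = inj₂ tt
  anyLWS⊎allRWF (x ∷ xs) with LWS⊎RWF x | anyLWS⊎allRWF xs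
  ... | inj₁ w | _ = inj₁ (inj₁ w)
  ... | inj₂ _ | inj₁ w = inj₁ (inj₂ w)
  ... | inj₂ v | inj₂ vs = inj₂ (v , vs)

  allLWF⊎anyRWS : ∀ xs → allLWF xs ⊎ anyRWS xs
  allLWF⊎anyRWS [] = inj₁ tt
  allLWF⊎anyRWS (x ∷ xs) with LWF⊎RWS x | allLWF⊎anyRWS xs
  ... | inj₂ v | _ = inj₂ (inj₁ v)
  ... | inj₁ _ | inj₂ v = inj₂ (inj₂ v)
  ... | inj₁ w | inj₁ ws = inj₁ (w , ws)

mutual
  LWF⇒¬RWS : ∀ G → LWF G → ¬ RWS G
  LWF⇒¬RWS ⟨ L ∣ R ⟩ w v = anyLWS⇒¬allRWF L w v

  LWS⇒¬RWF : ∀ G → LWS G → ¬ RWF G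
  LWS⇒¬RWF ⟨ L ∣ R ⟩ w v = allLWF⇒¬anyRWS R w v

  anyLWS⇒¬allRWF : ∀ xs → anyLWS xs → ¬ allRWF xs
  anyLWS⇒¬allRWF (x ∷ xs) (inj₁ w) (v , _) = LWS⇒¬RWF x w v
  anyLWS⇒¬allRWF (x ∷ xs) (inj₂ w) (_ , v) = anyLWS⇒¬allRWF xs w v

  allLWF⇒¬anyRWS : ∀ xs → allLWF xs → ¬ anyRWS xs
  allLWF⇒¬anyRWS (x ∷ xs) (w , _) (inj₁ v) = LWF⇒¬RWS x w v
  allLWF⇒¬anyRWS (x ∷ xs) (_ , w) (inj₂ v) = allLWF⇒¬anyRWS xs w v

≅-LWF×LWS : ∀ {G H} → G ≅ H → (LWF G → LWF H) × (LWS G → LWS H)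
≅-LWF×LWS {G} = go (◃-wellFounded G)
  where
  go : ∀ {G H} → Acc _◃_ G → G ≅ H → (LWF G → LWF H) × (LWS G → LWS H)
  go {∞} {∞} _ _ = id , id
  go { -∞} { -∞} _ _ = id , id
  go {G@(⟨ _ ∣ _ ⟩)} {H@(⟨ _ ∣ _ ⟩)} (acc r) e = first , second
    where
    first : LWF G → LWF H
    first w with x , x∈ , v ← anyLWS⁻ w with y , y∈ , x≅y ← proj₁ (≅⇒≋ ⟨⟩ ⟨⟩ e left) x∈ =
      anyLWS⁺ y∈ (proj₂ (go (r (◃ˡ x∈)) x≅y) v)
    second : LWS G → LWS H
    second w = allLWF⁺ λ y∈ → let x , x∈ , x≅y = proj₂ (≅⇒≋ ⟨⟩ ⟨⟩ e right) y∈ in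
      proj₁ (go (r (◃ʳ x∈)) x≅y) (allLWF⁻ w x∈)

≅-LWF : ∀ {G H} → G ≅ H → LWF G → LWF H
≅-LWF = proj₁ ∘ ≅-LWF×LWS

≅-LWS : ∀ {G H} → G ≅ H → LWS G → LWS H
≅-LWS = proj₂ ∘ ≅-LWF×LWS

≅-RWF : ∀ {G H} → G ≅ H → RWF G → RWF H
≅-RWF {G} {H} e = subst id (LWF-neg H) ∘ ≅-LWF (neg-cong e) ∘ subst id (sym (LWF-neg G))

≅-RWS : ∀ {G H} → G ≅ H → RWS G → RWS H
≅-RWS {G} {H} e = subst id (LWS-neg H) ∘ ≅-LWS (neg-cong e) ∘ subst id (sym (LWS-neg G))

≅⇒SameOutcome : ∀ {G H} → G ≅ H → SameOutcome G H
≅⇒SameOutcome e = mk⇔ (≅-LWF e) (≅-LWF (≅-sym e)) , mk⇔ (≅-RWF e) (≅-RWF (≅-sym e))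

module Accessible where
  mutual
    LWF⊕LWS : ∀ {G H} → Acc _◃_ G → Acc _◃_ H → LWF G → LWS H → LWF (G ⊕ H)
    LWF⊕LWS {∞} _ _ _ _ = tt
    LWF⊕LWS {⟨ _ ∣ _ ⟩} {∞} _ _ _ _ = tt
    LWF⊕LWS {⟨ _ ∣ _ ⟩} {⟨ _ ∣ _ ⟩} (acc r) aH w v with x , x∈ , wx ← anyLWS⁻ w =
      anyLWS⁺ (∈-⊕ˡ ⟨⟩ ⟨⟩ left x∈) (LWS⊕LWS (r (◃ˡ x∈)) aH wx v)

    LWS⊕LWF : ∀ {G H} → Acc _◃_ G → Acc _◃_ H → LWS G → LWF H → LWF (G ⊕ H)
    LWS⊕LWF {∞} _ _ _ _ = tt
    LWS⊕LWF {⟨ _ ∣ _ ⟩} {∞} _ _ _ _ = tt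
    LWS⊕LWF {⟨ _ ∣ _ ⟩} {⟨ _ ∣ _ ⟩} aG (acc r) w v with y , y∈ , vy ← anyLWS⁻ v =
      anyLWS⁺ (∈-⊕ʳ ⟨⟩ ⟨⟩ left y∈) (LWS⊕LWS aG (r (◃ˡ y∈)) w vy)

    LWS⊕LWS : ∀ {G H} → Acc _◃_ G → Acc _◃_ H → LWS G → LWS H → LWS (G ⊕ H)
    LWS⊕LWS {∞} _ _ _ _ = tt
    LWS⊕LWS {⟨ _ ∣ _ ⟩} {∞} _ _ _ _ = tt
    LWS⊕LWS {G@(⟨ _ ∣ _ ⟩)} {H@(⟨ _ ∣ _ ⟩)} (acc rG) (acc rH) w v = allLWF⁺ option-wins
      where
      option-wins : ∀ {z} → z ∈ rightOpts (G ⊕ H) → LWF z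
      option-wins z∈ with ∈-⊕⁻ {G} {H} ⟨⟩ ⟨⟩ right z∈
      ... | inj₁ (x , x∈ , refl) = LWF⊕LWS (rG (◃ʳ x∈)) (acc rH) (allLWF⁻ w x∈) v
      ... | inj₂ (y , y∈ , refl) = LWS⊕LWF (acc rG) (rH (◃ʳ y∈)) w (allLWF⁻ v y∈)

LWS⊕LWF : ∀ G H → LWS G → LWF H → LWF (G ⊕ H)
LWS⊕LWF G H = Accessible.LWS⊕LWF (◃-wellFounded G) (◃-wellFounded H)

LWS⊕LWS : ∀ G H → LWS G → LWS H → LWS (G ⊕ H)
LWS⊕LWS G H = Accessible.LWS⊕LWS (◃-wellFounded G) (◃-wellFounded H)

RWS⊕RWF : ∀ G H → RWS G → RWF H → RWF (G ⊕ H)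
RWS⊕RWF G H v w = subst id (trans (cong LWF (sym (neg-distrib-⊕ G H))) (LWF-neg (G ⊕ H)))
  (LWS⊕LWF (neg G) (neg H) (subst id (sym (LWS-neg G)) v) (subst id (sym (LWF-neg H)) w))

RWS⊕RWS : ∀ G H → RWS G → RWS H → RWS (G ⊕ H)
RWS⊕RWS G H v w = subst id (trans (cong LWS (sym (neg-distrib-⊕ G H))) (LWS-neg (G ⊕ H)))
  (LWS⊕LWS (neg G) (neg H) (subst id (sym (LWS-neg G)) v) (subst id (sym (LWS-neg H)) w))

SecondPlayerWin : Game → Set
SecondPlayerWin G = LWS G × RWS G

SecondPlayerWin-absorbs : ∀ H Y → SecondPlayerWin H → SameOutcome (H ⊕ Y) Y
SecondPlayerWin-absorbs H Y (l , r) = mk⇔ dropˡ (LWS⊕LWF H Y l) , mk⇔ dropʳ (RWS⊕RWF H Y r)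
  where
  dropˡ : LWF (H ⊕ Y) → LWF Y
  dropˡ w with LWF⊎RWS Y
  ... | inj₁ wY = wY
  ... | inj₂ vY = ⊥-elim (LWF⇒¬RWS (H ⊕ Y) w (RWS⊕RWS H Y r vY))
  dropʳ : RWF (H ⊕ Y) → RWF Y
  dropʳ v with LWS⊎RWF Y
  ... | inj₂ vY = vY
  ... | inj₁ wY = ⊥-elim (LWS⇒¬RWF (H ⊕ Y) (LWS⊕LWS H Y l wY) v)

SameOutcome-setoid : Setoid 0ℓ 0ℓ
SameOutcome-setoid = record
  { Carrier = Game ; _≈_ = SameOutcome
  ; isEquivalence = record
    { refl = ⇔.refl , ⇔.refl
    ; sym = λ (l , r) → ⇔.sym l , ⇔.sym r
    ; trans = λ (l , r) (l′ , r′) → ⇔.trans l l′ , ⇔.trans r r′ } }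

module SameOutcome-Reasoning = SetoidReasoning SameOutcome-setoid

≅⇒≈ : ∀ {G H} → G ≅ H → G ≈ H
≅⇒≈ e X _ = ≅⇒SameOutcome (⊕-cong e (≅-refl X))

≈-trans : ∀ {G H K} → G ≈ H → H ≈ K → G ≈ K
≈-trans {G} {H} {K} e e′ X i = Setoid.trans SameOutcome-setoid {G ⊕ X} {H ⊕ X} {K ⊕ X} (e X i) (e′ X i)

-- Impartial games and nimbers

⊕-impartial : ∀ {A B} → Impartial A → Impartial B → Impartial (A ⊕ B)
⊕-impartial {A} {B} a b = subst ((A ⊕ B) ≅_) (sym (neg-distrib-⊕ A B)) (⊕-cong a b)

Impartial-LWS⇔RWS : ∀ {G} → Impartial G → LWS G ⇔ RWS G
Impartial-LWS⇔RWS {G} i =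
  mk⇔ (subst id (LWS-neg G) ∘ ≅-LWS i) (subst id (RWS-neg G) ∘ ≅-RWS i)

∈-nimsBelow⁻ : ∀ {x} k → x ∈ nimsBelow k → ∃[ i ] i < k × x ≡ nim i
∈-nimsBelow⁻ (suc k) (here refl) = k , ≤-refl , refl
∈-nimsBelow⁻ (suc k) (there p) with i , i<k , refl ← ∈-nimsBelow⁻ k p = i , m≤n⇒m≤1+n i<k , refl

∈-nimsBelow⁺ : ∀ {i} k → i < k → nim i ∈ nimsBelow k
∈-nimsBelow⁺ (suc k) i<1+k with m≤n⇒m<n∨m≡n i<1+k
... | inj₂ refl = here refl
... | inj₁ i<k = there (∈-nimsBelow⁺ k (≤-pred i<k))

mutual
  neg-nim : ∀ k → neg (nim k) ≡ nim k
  neg-nim k = cong₂ ⟨_∣_⟩ (negs-nimsBelow k) (negs-nimsBelow k)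

  negs-nimsBelow : ∀ k → negs (nimsBelow k) ≡ nimsBelow k
  negs-nimsBelow zero = refl
  negs-nimsBelow (suc k) = cong₂ _∷_ (neg-nim k) (negs-nimsBelow k)

nim-impartial : ∀ k → Impartial (nim k)
nim-impartial k = subst (nim k ≅_) (sym (neg-nim k)) (≅-refl (nim k))

nim⊕nim-LWS : ∀ k → LWS (nim k ⊕ nim k)
nim⊕nim-LWS k = go (◃-wellFounded (nim k))
  where
  go : ∀ {k} → Acc _◃_ (nim k) → LWS (nim k ⊕ nim k)
  go {k} (acc r) = allLWF⁺ mirror
    where
    mirror : ∀ {z} → z ∈ rightOpts (nim k ⊕ nim k) → LWF z
    mirror z∈ with ∈-⊕⁻ {nim k} {nim k} ⟨⟩ ⟨⟩ right z∈
    ... | inj₁ (x , x∈ , refl) with i , i<k , refl ← ∈-nimsBelow⁻ k x∈ =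
      anyLWS⁺ (∈-⊕ʳ ⟨⟩ ⟨⟩ left (∈-nimsBelow⁺ k i<k)) (go (r (◃ʳ x∈)))
    ... | inj₂ (y , y∈ , refl) with i , i<k , refl ← ∈-nimsBelow⁻ k y∈ =
      anyLWS⁺ (∈-⊕ˡ ⟨⟩ ⟨⟩ left (∈-nimsBelow⁺ k i<k)) (go (r (◃ʳ y∈)))

nim⊕nim-SecondPlayerWin : ∀ k → SecondPlayerWin (nim k ⊕ nim k)
nim⊕nim-SecondPlayerWin k = nim⊕nim-LWS k ,
  Equivalence.to (Impartial-LWS⇔RWS (⊕-impartial (nim-impartial k) (nim-impartial k))) (nim⊕nim-LWS k)

⊕-interchange : ∀ A {B} C D → Form B → ((A ⊕ B) ⊕ (C ⊕ D)) ≅ ((A ⊕ C) ⊕ (B ⊕ D))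
⊕-interchange A {B} C D b = begin
  (A ⊕ B) ⊕ (C ⊕ D)  ≈⟨ ⊕-assoc A B (C ⊕ D) ⟩
  A ⊕ (B ⊕ (C ⊕ D))  ≈⟨ ⊕-cong (≅-refl A) (⊕-assoc B C D) ⟨
  A ⊕ ((B ⊕ C) ⊕ D)  ≈⟨ ⊕-cong (≅-refl A) (⊕-cong (⊕-comm C b) (≅-refl D)) ⟨
  A ⊕ ((C ⊕ B) ⊕ D)  ≈⟨ ⊕-cong (≅-refl A) (⊕-assoc C B D) ⟩
  A ⊕ (C ⊕ (B ⊕ D))  ≈⟨ ⊕-assoc A C (B ⊕ D) ⟨
  (A ⊕ C) ⊕ (B ⊕ D)  ∎
  where open ≅-Reasoning

SecondPlayerWin⊕nim⇒≈nim : ∀ G k → SecondPlayerWin (G ⊕ nim k) → G ≈ nim k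
SecondPlayerWin⊕nim⇒≈nim G k (l , r) X _ = begin
  G ⊕ X                          ≈⟨ SecondPlayerWin-absorbs (nim k ⊕ nim k) (G ⊕ X) (nim⊕nim-SecondPlayerWin k) ⟨
  (nim k ⊕ nim k) ⊕ (G ⊕ X)      ≈⟨ ≅⇒SameOutcome (⊕-interchange (nim k) G X ⟨⟩) ⟩
  (nim k ⊕ G) ⊕ (nim k ⊕ X)      ≈⟨ SecondPlayerWin-absorbs (nim k ⊕ G) (nim k ⊕ X) (≅-LWS G⊕a≅a⊕G l , ≅-RWS G⊕a≅a⊕G r) ⟩
  nim k ⊕ X                      ∎
  where
  open SameOutcome-Reasoning
  G⊕a≅a⊕G : (G ⊕ nim k) ≅ (nim k ⊕ G)
  G⊕a≅a⊕G = ⊕-comm G ⟨⟩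

LWF⊕nim⇒≉nim : ∀ G k → LWF (G ⊕ nim k) → ¬ G ≈ nim k
LWF⊕nim⇒≉nim G k w e = LWF⇒¬RWS (nim k ⊕ nim k)
  (Equivalence.to (proj₁ (e (nim k) (nim-impartial k))) w) (proj₂ (nim⊕nim-SecondPlayerWin k))

Impartial⇒LWF⊕nim⊎≈nim : ∀ {G} k → Impartial G → LWF (G ⊕ nim k) ⊎ G ≈ nim k
Impartial⇒LWF⊕nim⊎≈nim {G} k i with LWF⊎RWS (G ⊕ nim k)
... | inj₁ w = inj₁ w
... | inj₂ v = inj₂ (SecondPlayerWin⊕nim⇒≈nim G k
  (Equivalence.from (Impartial-LWS⇔RWS (⊕-impartial i (nim-impartial k))) v , v))

moon⊕-LWF : ∀ X → Impartial X → LWF (moon ⊕ X)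
moon⊕-LWF ∞ _ = tt
moon⊕-LWF -∞ ()
moon⊕-LWF ⟨ _ ∣ _ ⟩ _ = inj₁ tt

≈moon⇒⊕≉nimˡ : ∀ A B k → A ≈ moon → Impartial B → ¬ (A ⊕ B) ≈ nim k
≈moon⇒⊕≉nimˡ A B k e i = LWF⊕nim⇒≉nim (A ⊕ B) k (≅-LWF (≅-sym (⊕-assoc A B (nim k))) A⊕[B⊕a])
  where
  B⊕a-impartial : Impartial (B ⊕ nim k)
  B⊕a-impartial = ⊕-impartial i (nim-impartial k)
  A⊕[B⊕a] : LWF (A ⊕ (B ⊕ nim k))
  A⊕[B⊕a] = Equivalence.from (proj₁ (e (B ⊕ nim k) B⊕a-impartial)) (moon⊕-LWF (B ⊕ nim k) B⊕a-impartial)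

≈moon⇒⊕≉nimʳ : ∀ A B k → Form A → B ≈ moon → Impartial A → ¬ (A ⊕ B) ≈ nim k
≈moon⇒⊕≉nimʳ A B k a e i A⊕B≈a =
  ≈moon⇒⊕≉nimˡ B A k e i (≈-trans {B ⊕ A} {A ⊕ B} {nim k} (≅⇒≈ {B ⊕ A} {A ⊕ B} (⊕-comm B a)) A⊕B≈a)

-- Heaps

splits : ℕ → ℕ → List Game
splits f m = map (λ ℓ → heapF f ℓ ⊕ heapF f (suc m ∸ ℓ)) (map suc (upTo m))

entail : Side → ℕ → ℕ → Game
entail left f m = ⟨ ∞ ∷ [] ∣ rightOpts (heapF f m) ⟩
entail right f m = ⟨ leftOpts (heapF f m) ∣ -∞ ∷ [] ⟩

heapF-opts : ∀ s f m → opts s (heapF (suc f) (suc m)) ≡ splits f m ++ entail s f m ∷ []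
heapF-opts left f m = refl
heapF-opts right f m = refl

Form-heapF : ∀ f n → Form (heapF f n)
Form-heapF zero n = ⟨⟩
Form-heapF (suc f) zero = ⟨⟩
Form-heapF (suc f) (suc m) = ⟨⟩

∈-splits⁻ : ∀ {x} f m → x ∈ splits f m → ∃[ i ] i < m × x ≡ heapF f (suc i) ⊕ heapF f (m ∸ i)
∈-splits⁻ f m p with ℓ , ℓ∈ , refl ← ∈-map⁻ (λ ℓ → heapF f ℓ ⊕ heapF f (suc m ∸ ℓ)) p
                 with i , i∈ , refl ← ∈-map⁻ suc ℓ∈ = i , ∈-upTo⁻ i∈ , refl

∈-splits⁺ : ∀ {i} f m → i < m → heapF f (suc i) ⊕ heapF f (m ∸ i) ∈ splits f m
∈-splits⁺ f m i<m = ∈-map⁺ (λ ℓ → heapF f ℓ ⊕ heapF f (suc m ∸ ℓ)) (∈-map⁺ suc (∈-upTo⁺ i<m))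

heapF-fuel : ∀ {f g} n → n < f → n < g → heapF f n ≡ heapF g n
heapF-fuel {suc f} {suc g} zero _ _ = refl
heapF-fuel {suc f} {suc g} (suc m) (s≤s m<f) (s≤s m<g) =
  cong₂ (λ S H → ⟨ S ++ ⟨ ∞ ∷ [] ∣ rightOpts H ⟩ ∷ [] ∣ S ++ ⟨ leftOpts H ∣ -∞ ∷ [] ⟩ ∷ [] ⟩)
    (map-cong-local (tabulate same-split)) (heapF-fuel m m<f m<g)
  where
  same-split : ∀ {ℓ} → ℓ ∈ map suc (upTo m) →
               heapF f ℓ ⊕ heapF f (suc m ∸ ℓ) ≡ heapF g ℓ ⊕ heapF g (suc m ∸ ℓ)
  same-split p with i , i∈ , refl ← ∈-map⁻ suc p = cong₂ _⊕_
    (heapF-fuel (suc i) (≤-<-trans (∈-upTo⁻ i∈) m<f) (≤-<-trans (∈-upTo⁻ i∈) m<g))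
    (heapF-fuel (m ∸ i) (≤-<-trans (m∸n≤m m i) m<f) (≤-<-trans (m∸n≤m m i) m<g))

heapF≡heap : ∀ {f n} → n < f → heapF f n ≡ heap n
heapF≡heap {n = n} n<f = heapF-fuel n n<f ≤-refl

∈-heap-splits⁻ : ∀ {m x} → x ∈ splits (suc m) m →
  ∃[ ℓ ] ∃[ r ] (ℓ + r ≡ suc m) × (0 < ℓ) × (0 < r) × x ≡ heap ℓ ⊕ heap r
∈-heap-splits⁻ {m} p with i , i<m , refl ← ∈-splits⁻ (suc m) m p =
  suc i , m ∸ i , cong suc (m+[n∸m]≡n (<⇒≤ i<m)) , s≤s z≤n , m<n⇒0<n∸m i<m ,
  cong₂ _⊕_ (heapF≡heap (s≤s i<m)) (heapF≡heap (s≤s (m∸n≤m m i)))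

∈-heap-splits⁺ : ∀ {m ℓ r} → ℓ + r ≡ suc m → 0 < ℓ → 0 < r → heap ℓ ⊕ heap r ∈ splits (suc m) m
∈-heap-splits⁺ {m} {suc i} {suc j} eq _ _ =
  subst (_∈ splits (suc m) m) (cong₂ _⊕_ (heapF≡heap (s≤s i<m)) (heapF≡heap-r))
    (∈-splits⁺ (suc m) m i<m)
  where
  i+1+j≡m : i + suc j ≡ m
  i+1+j≡m = suc-injective eq
  i<m : i < m
  i<m = subst (i <_) i+1+j≡m (m<m+n i (s≤s z≤n))
  heapF≡heap-r : heapF (suc m) (m ∸ i) ≡ heap (suc j)
  heapF≡heap-r = trans (cong (heapF (suc m)) (trans (cong (_∸ i) (sym i+1+j≡m)) (m+n∸m≡n i (suc j))))
                       (heapF≡heap (s≤s (subst (suc j ≤_) i+1+j≡m (m≤n+m (suc j) i))))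

Impartials≋negs : ∀ {xs} → (∀ {x} → x ∈ xs → Impartial x) → xs ≋ negs xs
Impartials≋negs {xs} h = begin
  xs          ≡⟨ map-id xs ⟨
  map id xs   ≈⟨ map-pointwise-≋ h ⟩
  map neg xs  ≡⟨ negs≡map xs ⟨
  negs xs     ∎
  where open ≋-Reasoning

Impartial⇒opts≋negs : ∀ {G} → Form G → Impartial G → ∀ s → opts s G ≋ negs (opts (opposite s) G)
Impartial⇒opts≋negs {G} g i s = subst (opts s G ≋_) (neg-opts g s) (≅⇒≋ g (Form-neg g) i s)

singleton-≋ : ∀ {x y} → x ≅ y → x ∷ [] ≋ y ∷ []
singleton-≋ {x} {y} e = (λ { (here refl) → y , here refl , e }) , (λ { (here refl) → x , here refl , e })

entail-neg : ∀ s f m → Impartial (heapF f m) → entail s f m ≅ neg (entail (opposite s) f m)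
entail-neg left f m i = ≋⇒≅ ⟨⟩ ⟨⟩ λ
  { left → ≋-refl {∞ ∷ []} ; right → Impartial⇒opts≋negs (Form-heapF f m) i right }
entail-neg right f m i = ≋⇒≅ ⟨⟩ ⟨⟩ λ
  { left → Impartial⇒opts≋negs (Form-heapF f m) i left ; right → ≋-refl { -∞ ∷ []} }

mutual
  heapF-impartial : ∀ f n → Impartial (heapF f n)
  heapF-impartial zero n = tt , tt , tt , tt
  heapF-impartial (suc f) zero = tt , tt , tt , tt
  heapF-impartial (suc f) (suc m) = ≋⇒≅ ⟨⟩ ⟨⟩ λ s → begin
    opts s (heapF (suc f) (suc m))
      ≡⟨ heapF-opts s f m ⟩
    splits f m ++ entail s f m ∷ []
      ≈⟨ ++⁺-≋ (Impartials≋negs (splits-impartial f m))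
               (singleton-≋ (entail-neg s f m (heapF-impartial f m))) ⟩
    negs (splits f m) ++ negs (entail (opposite s) f m ∷ [])
      ≡⟨ trans (cong negs (heapF-opts (opposite s) f m)) (negs-++ (splits f m) _) ⟨
    negs (opts (opposite s) (heapF (suc f) (suc m)))
      ≡⟨ neg-opts ⟨⟩ s ⟨
    opts s (neg (heapF (suc f) (suc m))) ∎
    where open ≋-Reasoning

  splits-impartial : ∀ {x} f m → x ∈ splits f m → Impartial x
  splits-impartial f m p with i , _ , refl ← ∈-splits⁻ f m p =
    ⊕-impartial (heapF-impartial f (suc i)) (heapF-impartial f (m ∸ i))

heap-impartial : ∀ n → Impartial (heap n)
heap-impartial n = heapF-impartial (suc n) n

LeftCheck : Game → Set
LeftCheck G = ∞ ∈ leftOpts G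

LeftCheck⊕-LWF : ∀ {G Y} → Form G → Form Y → LeftCheck G → LWF (G ⊕ Y)
LeftCheck⊕-LWF ⟨⟩ ⟨⟩ c = anyLWS⁺ (∈-⊕ˡ ⟨⟩ ⟨⟩ left c) tt

⊕≡∞ˡ : ∀ {x B} → Form B → ∞ ≡ x ⊕ B → x ≡ ∞
⊕≡∞ˡ {∞} _ _ = refl
⊕≡∞ˡ { -∞} ⟨⟩ ()
⊕≡∞ˡ {⟨ _ ∣ _ ⟩} ⟨⟩ ()

⊕≡∞ʳ : ∀ {A y} → Form A → ∞ ≡ A ⊕ y → y ≡ ∞
⊕≡∞ʳ {y = ∞} ⟨⟩ _ = refl
⊕≡∞ʳ {y = -∞} ⟨⟩ ()
⊕≡∞ʳ {y = ⟨ _ ∣ _ ⟩} ⟨⟩ ()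

¬LeftCheck-⊕ : ∀ {A B} → Form A → Form B → ¬ LeftCheck A → ¬ LeftCheck B → ¬ LeftCheck (A ⊕ B)
¬LeftCheck-⊕ {A} {B} a b ¬cA ¬cB c with ∈-⊕⁻ a b left c
... | inj₁ (x , x∈ , eq) = ¬cA (subst (_∈ leftOpts A) (⊕≡∞ˡ b eq) x∈)
... | inj₂ (y , y∈ , eq) = ¬cB (subst (_∈ leftOpts B) (⊕≡∞ʳ a eq) y∈)

¬Form∞ : ¬ Form ∞
¬Form∞ ()

heapF-¬LeftCheck : ∀ f n → ¬ LeftCheck (heapF f n)
heapF-¬LeftCheck (suc f) (suc m) c with ∈-++⁻ (splits f m) c
... | inj₁ p with i , _ , eq ← ∈-splits⁻ f m p =
  ¬Form∞ (subst Form (sym eq) (Form-⊕ (Form-heapF f (suc i)) (Form-heapF f (m ∸ i))))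
... | inj₂ (here ())
... | inj₂ (there ())

splits-¬LeftCheck : ∀ {x} f m → x ∈ splits f m → ¬ LeftCheck x
splits-¬LeftCheck f m p with i , _ , refl ← ∈-splits⁻ f m p =
  ¬LeftCheck-⊕ (Form-heapF f (suc i)) (Form-heapF f (m ∸ i))
    (heapF-¬LeftCheck f (suc i)) (heapF-¬LeftCheck f (m ∸ i))

LeftCheck⇒In𝓛⊕nim⇔ : ∀ {G} k → Form G → LeftCheck G →
  In𝓛 (G ⊕ nim k) ⇔ (∀ {r} → r ∈ rightOpts G → LWF (r ⊕ nim k))
LeftCheck⇒In𝓛⊕nim⇔ {G@(⟨ _ ∣ _ ⟩)} k ⟨⟩ c = mk⇔ to from
  where
  to : In𝓛 (G ⊕ nim k) → ∀ {r} → r ∈ rightOpts G → LWF (r ⊕ nim k)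
  to (_ , ls) r∈ = allLWF⁻ ls (∈-⊕ˡ ⟨⟩ ⟨⟩ right r∈)
  from : (∀ {r} → r ∈ rightOpts G → LWF (r ⊕ nim k)) → In𝓛 (G ⊕ nim k)
  from h = LeftCheck⊕-LWF ⟨⟩ ⟨⟩ c , allLWF⁺ answer
    where
    answer : ∀ {z} → z ∈ rightOpts (G ⊕ nim k) → LWF z
    answer z∈ with ∈-⊕⁻ {G} {nim k} ⟨⟩ ⟨⟩ right z∈
    ... | inj₁ (r , r∈ , refl) = h r∈
    ... | inj₂ (y , y∈ , refl) with i , _ , refl ← ∈-nimsBelow⁻ k y∈ = LeftCheck⊕-LWF ⟨⟩ ⟨⟩ c

-- Immediate and protected nimbers of a heap

InP-heap⇔In𝓛-entail : ∀ m k → InP (heap (suc m)) k ⇔ In𝓛 (entail left (suc m) m ⊕ nim k)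
InP-heap⇔In𝓛-entail m k = mk⇔ to (λ w → inj₂ (entail left (suc m) m , ∈-++⁺ʳ _ (here refl) , here refl , w))
  where
  to : InP (heap (suc m)) k → In𝓛 (entail left (suc m) m ⊕ nim k)
  to (inj₁ c) = ⊥-elim (heapF-¬LeftCheck (suc (suc m)) (suc m) c)
  to (inj₂ (GL , q , c , w)) with ∈-++⁻ (splits (suc m) m) q
  ... | inj₁ p = ⊥-elim (splits-¬LeftCheck (suc m) m p c)
  ... | inj₂ (here refl) = w

entailˡ⊕nim-LWF : ∀ f m k → LWF (entail left f m ⊕ nim k)
entailˡ⊕nim-LWF f m k = LeftCheck⊕-LWF {entail left f m} {nim k} ⟨⟩ ⟨⟩ (here refl)

entailʳ⊕nim≅neg : ∀ f m k → Impartial (heapF f m) →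
                  (entail right f m ⊕ nim k) ≅ neg (entail left f m ⊕ nim k)
entailʳ⊕nim≅neg f m k i = subst ((entail right f m ⊕ nim k) ≅_) (sym (neg-distrib-⊕ (entail left f m) (nim k)))
  (⊕-cong (entail-neg right f m i) (nim-impartial k))

heap-rightOpts-LWF⇔ : ∀ m k →
  (∀ {r} → r ∈ rightOpts (heap m) → LWF (r ⊕ nim k)) ⇔ (¬ (InS (heap m) k ⊎ InP (heap m) k))
heap-rightOpts-LWF⇔ zero k = mk⇔
  (λ _ → λ { (inj₁ (_ , () , _)) ; (inj₂ (inj₁ ())) ; (inj₂ (inj₂ (_ , () , _))) }) (λ _ ())
heap-rightOpts-LWF⇔ (suc m) k = mk⇔ to from
  where
  E = entail left (suc m) m
  E′ = entail right (suc m) m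
  E′⊕a≅neg : (E′ ⊕ nim k) ≅ neg (E ⊕ nim k)
  E′⊕a≅neg = entailʳ⊕nim≅neg (suc m) m k (heap-impartial m)
  to : (∀ {r} → r ∈ rightOpts (heap (suc m)) → LWF (r ⊕ nim k)) → ¬ (InS (heap (suc m)) k ⊎ InP (heap (suc m)) k)
  to h (inj₁ (GL , q , e)) with ∈-++⁻ (splits (suc m) m) q
  ... | inj₁ p = LWF⊕nim⇒≉nim GL k (h (∈-++⁺ˡ p)) e
  ... | inj₂ (here refl) = LWF⊕nim⇒≉nim E k (entailˡ⊕nim-LWF (suc m) m k) e
  to h (inj₂ p) = LWS⇒¬RWF (E ⊕ nim k) (proj₂ (Equivalence.to (InP-heap⇔In𝓛-entail m k) p))
    (subst id (LWF-neg (E ⊕ nim k)) (≅-LWF E′⊕a≅neg (h (∈-++⁺ʳ _ (here refl)))))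
  from : ¬ (InS (heap (suc m)) k ⊎ InP (heap (suc m)) k) → ∀ {r} → r ∈ rightOpts (heap (suc m)) → LWF (r ⊕ nim k)
  from ¬SP {r} q with ∈-++⁻ (splits (suc m) m) q
  ... | inj₁ p with Impartial⇒LWF⊕nim⊎≈nim k (splits-impartial (suc m) m p)
  ...   | inj₁ w = w
  ...   | inj₂ e = ⊥-elim (¬SP (inj₁ (r , ∈-++⁺ˡ p , e)))
  from ¬SP q | inj₂ (here refl) with LWF⊎RWS (E′ ⊕ nim k)
  ...   | inj₁ w = w
  ...   | inj₂ v = ⊥-elim (¬SP (inj₂ (Equivalence.from (InP-heap⇔In𝓛-entail m k)
            (entailˡ⊕nim-LWF (suc m) m k , subst id (RWS-neg (E ⊕ nim k)) (≅-RWS E′⊕a≅neg v)))))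

NimberSplit : ℕ → ℕ → Set
NimberSplit n k = Σ ℕ (λ ℓ → Σ ℕ (λ m →
  (ℓ + m ≡ n) × (0 < ℓ) × (0 < m) ×
  ¬ (heap ℓ ≈ moon) × ¬ (heap m ≈ moon) × (heap ℓ ⊕ heap m ≈ nim k)))

InS-heap⇔NimberSplit : ∀ m k → InS (heap (suc m)) k ⇔ NimberSplit (suc m) k
InS-heap⇔NimberSplit m k = mk⇔ to from
  where
  to : InS (heap (suc m)) k → NimberSplit (suc m) k
  to (GL , q , e) with ∈-++⁻ (splits (suc m) m) q
  ... | inj₂ (here refl) = ⊥-elim (LWF⊕nim⇒≉nim _ k (entailˡ⊕nim-LWF (suc m) m k) e)
  ... | inj₁ p with ℓ , r , ℓ+r≡n , 0<ℓ , 0<r , refl ← ∈-heap-splits⁻ p =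
    ℓ , r , ℓ+r≡n , 0<ℓ , 0<r ,
    (λ ℓ≈moon → ≈moon⇒⊕≉nimˡ (heap ℓ) (heap r) k ℓ≈moon (heap-impartial r) e) ,
    (λ r≈moon → ≈moon⇒⊕≉nimʳ (heap ℓ) (heap r) k (Form-heapF (suc ℓ) ℓ) r≈moon (heap-impartial ℓ) e) ,
    e
  from : NimberSplit (suc m) k → InS (heap (suc m)) k
  from (ℓ , r , ℓ+r≡n , 0<ℓ , 0<r , _ , _ , e) =
    heap ℓ ⊕ heap r , ∈-++⁺ˡ (∈-heap-splits⁺ ℓ+r≡n 0<ℓ 0<r) , e

theorem5p1 : ((k : ℕ) → ¬ InP (heap 0) k) ×
    ((k : ℕ) → ¬ InS (heap 0) k) ×
    ((n : ℕ) → 0 < n → (k : ℕ) →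
      (InP (heap n) k ⇔ (¬ (InS (heap (n ∸ 1)) k ⊎ InP (heap (n ∸ 1)) k))) ×
      (InS (heap n) k ⇔
        Σ ℕ (λ ℓ → Σ ℕ (λ m →
          (ℓ + m ≡ n) × (0 < ℓ) × (0 < m) ×
          ¬ (heap ℓ ≈ moon) × ¬ (heap m ≈ moon) ×
          (heap ℓ ⊕ heap m ≈ nim k)))))
theorem5p1 = noP₀ , noS₀ , λ { (suc m) _ k → InP-heap-suc m k , InS-heap⇔NimberSplit m k }
  where
  noP₀ : ∀ k → ¬ InP (heap 0) k
  noP₀ k (inj₁ ())
  noP₀ k (inj₂ (_ , () , _))
  noS₀ : ∀ k → ¬ InS (heap 0) k
  noS₀ k (_ , () , _)
  InP-heap-suc : ∀ m k → InP (heap (suc m)) k ⇔ (¬ (InS (heap m) k ⊎ InP (heap m) k))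
  InP-heap-suc m k = ⇔.trans (InP-heap⇔In𝓛-entail m k)
    (⇔.trans (LeftCheck⇒In𝓛⊕nim⇔ k ⟨⟩ (here refl)) (heap-rightOpts-LWF⇔ m k))
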